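{- Let $L_1$ and $L_2$ be lists (multisets) of positive integers. If each of $L_1$ and $L_2$ has a standard linear realization, then the multiset union $L=L_1\cup L_2$ has a linear realization.
   Context: For a list (multiset) $L$ of positive integers with $|L|$ elements, a linear realization of $L$ is an ordering $[x_0,x_1,\ldots,x_{|L|}]$ of the integers $\{0,1,\ldots,|L|\}$ (i.e., a Hamiltonian path of the complete graph on these vertices) such that the multiset $\{|x_i-x_{i+1}| : 0\leq i\leq |L|-1\}$ equals $L$. A linear realization is standard if $x_0=0$. -}

module Defs where

open import Data.Nat using (ℕ; zero; suc; ∣_-_∣; _<_)
open import Data.List using (List; []; _∷_; length; upTo)
open import Data.List.Relation.Binary.Permutation.Propositional using (_↭_)
open import Data.List.Relation.Unary.All using (All)
open import Data.Product using (_×_)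
open import Relation.Binary.PropositionalEquality using (_≡_)

diffs : List ℕ → List ℕ
diffs []           = []
diffs (x ∷ [])     = []
diffs (x ∷ y ∷ xs) = ∣ x - y ∣ ∷ diffs (y ∷ xs)

Positive : List ℕ → Set
Positive L = All (λ n → 0 < n) L

LinearRealization : List ℕ → List ℕ → Set
LinearRealization L xs = (xs ↭ upTo (suc (length L))) × (diffs xs ↭ L)

StandardLinearRealization : List ℕ → List ℕ → Set
StandardLinearRealization L [] = LinearRealization L []
StandardLinearRealization L (x ∷ xs) = LinearRealization L (x ∷ xs) × (x ≡ 0)

-- Let x = [0, x₁, …, x_m] realize L₁ on {0,…,m} and y = [0, y₁, …, y_n]
-- realize L₂ on {0,…,n}.  The difference multiset of a path is unchanged by
-- three operations: reflecting the vertices (v ↦ m ∸ v, for paths inside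
-- {0,…,m}), shifting them (v ↦ k + v), and reversing the path.  Reflecting
-- x gives a path from m through {0,…,m}; reversing y and shifting it by m
-- gives a path through {m,…,m+n} ending at m.  Gluing the second path to
-- the first at the common vertex m yields a Hamiltonian path on {0,…,m+n}
-- whose differences are those of both pieces, i.e. L₂ ++ L₁ ↭ L₁ ++ L₂.
--
-- Positivity of the entries is not
-- needed for the construction.
module Submission where

open import Defs
open import Data.Nat using (ℕ; zero; suc; _+_; _∸_; _≤_; s≤s⁻¹; ∣_-_∣)
open import Data.Nat.Properties using (∣m+n-m+o∣≡∣n-o∣; ∣-∣-comm; +-assoc; +-comm; m+[n∸m]≡n; +-identityʳ; +-suc)
open import Data.List using (List; []; _∷_; _++_; [_]; map; reverse; length; upTo; applyUpTo; downFrom)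
open import Data.List.Properties using (unfold-reverse; ++-assoc; map-++; map-∘; map-cong; map-upTo; reverse-downFrom; length-++)
open import Data.List.Relation.Unary.All using (All; _∷_)
open import Data.List.Relation.Unary.All.Properties using (applyUpTo⁺₁)
open import Data.List.Relation.Binary.Permutation.Propositional using (_↭_; ↭-trans; ↭-sym; ↭-reflexive; module PermutationReasoning)
open import Data.List.Relation.Binary.Permutation.Propositional.Properties using (¬x∷xs↭[]; ↭-reverse; ++-comm; ++⁺; ++⁺ʳ; map⁺; drop-∷; All-resp-↭)
open import Data.Product using (∃; _,_)
open import Data.Empty using (⊥-elim)
open import Function using (_∘_; id)
open import Relation.Binary.PropositionalEquality using (_≡_; refl; sym; trans; cong; cong₂; module ≡-Reasoning)

diffs-glue : ∀ (R : List ℕ) a Q → diffs (R ++ a ∷ Q) ≡ diffs (R ++ [ a ]) ++ diffs (a ∷ Q)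
diffs-glue []          a Q = refl
diffs-glue (x ∷ [])    a Q = refl
diffs-glue (x ∷ y ∷ R) a Q = cong (∣ x - y ∣ ∷_) (diffs-glue (y ∷ R) a Q)

diffs-reverse : ∀ xs → diffs (reverse xs) ≡ reverse (diffs xs)
diffs-reverse []           = refl
diffs-reverse (a ∷ [])     = refl
diffs-reverse (a ∷ b ∷ xs) = begin
  diffs (reverse (a ∷ b ∷ xs))                   ≡⟨ cong diffs reverse-split ⟩
  diffs (reverse xs ++ b ∷ [ a ])                ≡⟨ diffs-glue (reverse xs) b [ a ] ⟩
  diffs (reverse xs ++ [ b ]) ++ [ ∣ b - a ∣ ]   ≡⟨ cong₂ _++_ (cong diffs (sym (unfold-reverse b xs))) (cong [_] (∣-∣-comm b a)) ⟩
  diffs (reverse (b ∷ xs)) ++ [ ∣ a - b ∣ ]      ≡⟨ cong (_++ [ ∣ a - b ∣ ]) (diffs-reverse (b ∷ xs)) ⟩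
  reverse (diffs (b ∷ xs)) ++ [ ∣ a - b ∣ ]      ≡⟨ sym (unfold-reverse ∣ a - b ∣ (diffs (b ∷ xs))) ⟩
  reverse (diffs (a ∷ b ∷ xs))                   ∎
  where
  open ≡-Reasoning
  reverse-split : reverse (a ∷ b ∷ xs) ≡ reverse xs ++ b ∷ [ a ]
  reverse-split = trans (unfold-reverse a (b ∷ xs))
    (trans (cong (_++ [ a ]) (unfold-reverse b xs)) (++-assoc (reverse xs) [ b ] [ a ]))

diffs-reverse-↭ : ∀ xs → diffs (reverse xs) ↭ diffs xs
diffs-reverse-↭ xs = ↭-trans (↭-reflexive (diffs-reverse xs)) (↭-reverse (diffs xs))

diffs-shift : ∀ k xs → diffs (map (k +_) xs) ≡ diffs xs
diffs-shift k []           = refl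
diffs-shift k (a ∷ [])     = refl
diffs-shift k (a ∷ b ∷ xs) = cong₂ _∷_ (∣m+n-m+o∣≡∣n-o∣ k a b) (diffs-shift k (b ∷ xs))

-- Reflection v ↦ m ∸ v is an isometry of {0,…,m}: adding a + b to both
-- reflected points turns them into m + b and m + a.
reflect-distance : ∀ {m a b} → a ≤ m → b ≤ m → ∣ m ∸ a - m ∸ b ∣ ≡ ∣ a - b ∣
reflect-distance {m} {a} {b} a≤m b≤m = begin
  ∣ m ∸ a - m ∸ b ∣                 ≡⟨ sym (∣m+n-m+o∣≡∣n-o∣ (a + b) (m ∸ a) (m ∸ b)) ⟩
  ∣ a + b + (m ∸ a) - a + b + (m ∸ b) ∣ ≡⟨ cong₂ ∣_-_∣ shifted-a shifted-b ⟩
  ∣ m + b - m + a ∣                 ≡⟨ ∣m+n-m+o∣≡∣n-o∣ m b a ⟩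
  ∣ b - a ∣                         ≡⟨ ∣-∣-comm b a ⟩
  ∣ a - b ∣                         ∎
  where
  open ≡-Reasoning
  swap-last : ∀ u v w → u + v + w ≡ u + w + v
  swap-last u v w = trans (+-assoc u v w) (trans (cong (u +_) (+-comm v w)) (sym (+-assoc u w v)))
  shifted-a : a + b + (m ∸ a) ≡ m + b
  shifted-a = trans (swap-last a b (m ∸ a)) (cong (_+ b) (m+[n∸m]≡n a≤m))
  shifted-b : a + b + (m ∸ b) ≡ m + a
  shifted-b = trans (cong (_+ (m ∸ b)) (+-comm a b))
                (trans (swap-last b a (m ∸ b)) (cong (_+ a) (m+[n∸m]≡n b≤m)))

diffs-reflect : ∀ m xs → All (_≤ m) xs → diffs (map (m ∸_) xs) ≡ diffs xs
diffs-reflect m []           _                = refl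
diffs-reflect m (a ∷ [])     _                = refl
diffs-reflect m (a ∷ b ∷ xs) (a≤m ∷ b≤m ∷ ps) =
  cong₂ _∷_ (reflect-distance a≤m b≤m) (diffs-reflect m (b ∷ xs) (b≤m ∷ ps))

bounded-by-top : ∀ {m xs} → xs ↭ upTo (suc m) → All (_≤ m) xs
bounded-by-top {m} xs↭ = All-resp-↭ (↭-sym xs↭) (applyUpTo⁺₁ id (suc m) s≤s⁻¹)

reflect-upTo : ∀ m → map (m ∸_) (upTo (suc m)) ≡ downFrom (suc m)
reflect-upTo m = trans (map-upTo (m ∸_) (suc m)) (descending m)
  where
  descending : ∀ k → applyUpTo (k ∸_) (suc k) ≡ downFrom (suc k)
  descending zero    = refl
  descending (suc k) = cong (suc k ∷_) (descending k)

reflect-upTo-↭ : ∀ m → map (m ∸_) (upTo (suc m)) ↭ upTo (suc m)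
reflect-upTo-↭ m = begin
  map (m ∸_) (upTo (suc m))       ≡⟨ reflect-upTo m ⟩
  downFrom (suc m)                ↭⟨ ↭-sym (↭-reverse (downFrom (suc m))) ⟩
  reverse (downFrom (suc m))      ≡⟨ reverse-downFrom (suc m) ⟩
  upTo (suc m)                    ∎
  where open PermutationReasoning

applyUpTo-++ : ∀ (f : ℕ → ℕ) a b → applyUpTo f (a + b) ≡ applyUpTo f a ++ applyUpTo (f ∘ (a +_)) b
applyUpTo-++ f zero    b = refl
applyUpTo-++ f (suc a) b = cong (f 0 ∷_) (applyUpTo-++ (f ∘ suc) a b)

upTo-++ : ∀ a b → upTo (a + b) ≡ upTo a ++ map (a +_) (upTo b)
upTo-++ a b = trans (applyUpTo-++ id a b) (cong (upTo a ++_) (sym (map-upTo (a +_) b)))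

shifted-tail : ∀ k {n ys} → 0 ∷ ys ↭ upTo (suc n) → map (k +_) ys ↭ map (suc k +_) (upTo n)
shifted-tail k {n} {ys} p = begin
  map (k +_) ys                      ↭⟨ map⁺ (k +_) (drop-∷ p) ⟩
  map (k +_) (applyUpTo suc n)       ≡⟨ cong (map (k +_)) (sym (map-upTo suc n)) ⟩
  map (k +_) (map suc (upTo n))      ≡⟨ sym (map-∘ (upTo n)) ⟩
  map (λ i → k + suc i) (upTo n)     ≡⟨ map-cong (+-suc k) (upTo n) ⟩
  map (suc k +_) (upTo n)            ∎
  where open PermutationReasoning

-- y reversed and shifted by m (a path ending at m, written without its
-- final vertex), then x reflected in m (a path starting at m).
join : ℕ → List ℕ → List ℕ → List ℕ
join m xt yt = map (m +_) (reverse yt) ++ m ∷ map (m ∸_) xt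

join-vertices : ∀ {m n xt yt} → 0 ∷ xt ↭ upTo (suc m) → 0 ∷ yt ↭ upTo (suc n) →
                join m xt yt ↭ upTo (suc m + n)
join-vertices {m} {n} {xt} {yt} px py = begin
  map (m +_) (reverse yt) ++ m ∷ map (m ∸_) xt    ↭⟨ ++-comm (map (m +_) (reverse yt)) _ ⟩
  map (m ∸_) (0 ∷ xt) ++ map (m +_) (reverse yt)  ↭⟨ ++⁺ reflected shifted ⟩
  upTo (suc m) ++ map (suc m +_) (upTo n)         ≡⟨ sym (upTo-++ (suc m) n) ⟩
  upTo (suc m + n)                                ∎
  where
  open PermutationReasoning
  reflected : map (m ∸_) (0 ∷ xt) ↭ upTo (suc m)
  reflected = ↭-trans (map⁺ (m ∸_) px) (reflect-upTo-↭ m)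
  shifted : map (m +_) (reverse yt) ↭ map (suc m +_) (upTo n)
  shifted = ↭-trans (map⁺ (m +_) (↭-reverse yt)) (shifted-tail m py)

join-diffs : ∀ {m} xt yt → All (_≤ m) (0 ∷ xt) →
             diffs (join m xt yt) ↭ diffs (0 ∷ yt) ++ diffs (0 ∷ xt)
join-diffs {m} xt yt bounded = begin
  diffs (join m xt yt)                                       ≡⟨ diffs-glue (map (m +_) (reverse yt)) m _ ⟩
  diffs (map (m +_) (reverse yt) ++ [ m ]) ++ diffs (m ∷ map (m ∸_) xt)
                                                             ≡⟨ cong₂ _++_ y-part x-part ⟩
  diffs (reverse (0 ∷ yt)) ++ diffs (0 ∷ xt)                 ↭⟨ ++⁺ʳ (diffs (0 ∷ xt)) (diffs-reverse-↭ (0 ∷ yt)) ⟩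
  diffs (0 ∷ yt) ++ diffs (0 ∷ xt)                           ∎
  where
  open PermutationReasoning
  end-vertex : map (m +_) (reverse yt) ++ [ m ] ≡ map (m +_) (reverse (0 ∷ yt))
  end-vertex = ≡.begin
    map (m +_) (reverse yt) ++ [ m ]        ≡.≡⟨ cong (λ v → map (m +_) (reverse yt) ++ [ v ]) (sym (+-identityʳ m)) ⟩
    map (m +_) (reverse yt) ++ [ m + 0 ]    ≡.≡⟨ sym (map-++ (m +_) (reverse yt) [ 0 ]) ⟩
    map (m +_) (reverse yt ++ [ 0 ])        ≡.≡⟨ cong (map (m +_)) (sym (unfold-reverse 0 yt)) ⟩
    map (m +_) (reverse (0 ∷ yt))           ≡.∎
    where module ≡ = ≡-Reasoning
  y-part : diffs (map (m +_) (reverse yt) ++ [ m ]) ≡ diffs (reverse (0 ∷ yt))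
  y-part = trans (cong diffs end-vertex) (diffs-shift m (reverse (0 ∷ yt)))
  x-part : diffs (m ∷ map (m ∸_) xt) ≡ diffs (0 ∷ xt)
  x-part = diffs-reflect m (0 ∷ xt) bounded

theorem2p2 : (L₁ L₂ : List ℕ) → Positive L₁ → Positive L₂ →
    ∃ (λ xs → StandardLinearRealization L₁ xs) →
    ∃ (λ ys → StandardLinearRealization L₂ ys) →
    ∃ (λ zs → LinearRealization (L₁ ++ L₂) zs)
theorem2p2 L₁ L₂ _ _ ([] , vx , _) _ = ⊥-elim (¬x∷xs↭[] (↭-sym vx))
theorem2p2 L₁ L₂ _ _ _ ([] , vy , _) = ⊥-elim (¬x∷xs↭[] (↭-sym vy))
theorem2p2 L₁ L₂ _ _ (.0 ∷ xt , (vx , dx) , refl) (.0 ∷ yt , (vy , dy) , refl) =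
  join m xt yt , vertices , differences
  where
  open PermutationReasoning
  m : ℕ
  m = length L₁
  vertices : join m xt yt ↭ upTo (suc (length (L₁ ++ L₂)))
  vertices = ↭-trans (join-vertices vx vy) (↭-reflexive (cong (upTo ∘ suc) (sym (length-++ L₁))))
  differences : diffs (join m xt yt) ↭ L₁ ++ L₂
  differences = begin
    diffs (join m xt yt)               ↭⟨ join-diffs xt yt (bounded-by-top vx) ⟩
    diffs (0 ∷ yt) ++ diffs (0 ∷ xt)   ↭⟨ ++⁺ dy dx ⟩
    L₂ ++ L₁                           ↭⟨ ++-comm L₂ L₁ ⟩
    L₁ ++ L₂                           ∎
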